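{- Let $A$ be a finite abelian group. If $[a,b]$ and $[c,d]$ are vertices of the K\"ohler graph of $A$ lying in the same connected component, then $\langle a,b\rangle=\langle c,d\rangle$.
   Context: For a finite abelian group $A$ (additive), $\hat A$ is the permutation group on $A$ generated by translations $x\mapsto x+a$ and $x\mapsto -x$; $[a_1,\dots,a_t]$ denotes the $\hat A$-orbit $\{\{0,a_1,\dots,a_t\}+c\}_{c\in A}\cup\{ -\{0,a_1,\dots,a_t\}+c\}_{c\in A}$. Let $\mathcal T=\{[a,b]: a,b\in A,\ a\ne\pm b,\ 2a\notin\{0,b,2b\},\ 2b\notin\{0,a,2a\}\}$ and $\mathcal E=\{[a,b,a+b]: a,b\in A,\ 0\notin\{2a,2b\},\ \{\pm a,\pm 2a\}\cap\{\pm b,\pm 2b\}=\emptyset\}$. The K\"ohler graph of $A$ has vertex set $\mathcal T$ and edge set $\mathcal E$, the orbit of a triple $T$ being incident with the orbit of a quadruple $B$ if $B\supseteq T'$ for some $T'$ in the orbit of $T$; two vertices are adjacent if they are incident with a common edge. -}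

module Defs where

open import Level using (0ℓ)
open import Data.Nat using (ℕ)
open import Data.Integer using (ℤ; +_; -[1+_])
open import Data.Fin using (Fin)
open import Data.Bool using (Bool; true; false)
open import Data.Product using (Σ; ∃; _×_; _,_)
open import Data.List using (List; []; _∷_; map)
open import Data.List.Membership.Propositional using (_∈_)
open import Data.List.Relation.Unary.All using (All)
open import Relation.Binary.PropositionalEquality using (_≡_; _≢_)
open import Relation.Binary.Construct.Closure.ReflexiveTransitive using (Star)
open import Relation.Nullary using (¬_)
open import Function.Bundles using (_↔_; _⇔_)
open import Algebra.Structures using (IsAbelianGroup)

record FiniteAbelianGroup : Set₁ where
  infixl 6 _+_
  field
    Carrier : Set
    _+_     : Carrier → Carrier → Carrier
    0#      : Carrier
    -_      : Carrier → Carrier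
    isAbelianGroup : IsAbelianGroup _≡_ _+_ 0# -_
    size    : ℕ
    enum    : Fin size ↔ Carrier

module Köhler (G : FiniteAbelianGroup) where
  open FiniteAbelianGroup G

  dbl : Carrier → Carrier
  dbl x = x + x

  _·ℕ_ : ℕ → Carrier → Carrier
  ℕ.zero ·ℕ x = 0#
  ℕ.suc n ·ℕ x = x + (n ·ℕ x)

  _·_ : ℤ → Carrier → Carrier
  (+ n) · x = n ·ℕ x
  -[1+ n ] · x = - (ℕ.suc n ·ℕ x)

  InSpan : Carrier → Carrier → Carrier → Set
  InSpan a b x = ∃ λ (m : ℤ) → ∃ λ (n : ℤ) → x ≡ (m · a) + (n · b)

  SameSpan : Carrier → Carrier → Carrier → Carrier → Set
  SameSpan a b c d = (x : Carrier) → InSpan a b x ⇔ InSpan c d x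

  -- the element of Â given by x ↦ ±x + c  (true = +, false = -)
  act : Bool → Carrier → Carrier → Carrier
  act true  c x = x + c
  act false c x = (- x) + c

  _⊆_ : List Carrier → List Carrier → Set
  S ⊆ S' = All (λ x → x ∈ S') S

  triple : Carrier → Carrier → List Carrier
  triple a b = 0# ∷ a ∷ b ∷ []

  quadruple : Carrier → Carrier → List Carrier
  quadruple a b = 0# ∷ a ∷ b ∷ (a + b) ∷ []

  IsVertex : Carrier → Carrier → Set
  IsVertex a b =
    a ≢ b × a ≢ (- b) ×
    dbl a ≢ 0# × dbl a ≢ b × dbl a ≢ dbl b ×
    dbl b ≢ 0# × dbl b ≢ a × dbl b ≢ dbl a

  IsEdge : Carrier → Carrier → Set
  IsEdge a b =
    dbl a ≢ 0# × dbl b ≢ 0# ×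
    ((x y : Carrier) →
       x ∈ (a ∷ (- a) ∷ dbl a ∷ (- dbl a) ∷ []) →
       y ∈ (b ∷ (- b) ∷ dbl b ∷ (- dbl b) ∷ []) → x ≢ y)

  -- the orbit [a,b] is incident with the orbit [e,f,e+f]: some member of the
  -- quadruple orbit contains some member of the triple orbit
  Incident : Carrier → Carrier → Carrier → Carrier → Set
  Incident a b e f =
    ∃ λ (s : Bool) → ∃ λ (c : Carrier) → ∃ λ (s' : Bool) → ∃ λ (c' : Carrier) →
      map (act s c) (triple a b) ⊆ map (act s' c') (quadruple e f)

  Adjacent : Carrier × Carrier → Carrier × Carrier → Set
  Adjacent (a , b) (c , d) =
    IsVertex a b × IsVertex c d ×
    (∃ λ e → ∃ λ f → IsEdge e f × Incident a b e f × Incident c d e f)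

  SameComponent : Carrier × Carrier → Carrier × Carrier → Set
  SameComponent = Star Adjacent

-- Every element of Â moves a difference x - y only by a sign. So if some image of {0, a, b}
-- lies in some image of {0, e, f, e + f}, then 0, a, b (distinct, as 2a, 2b ≠ 0 and a ≠ b)
-- correspond to three distinct corners of the parallelogram 0, e, f, e + f, and the differences
-- of the triangle agree with differences of corners up to sign; hence a, b ∈ ⟨e, f⟩. Coding the
-- corners by Bool × Bool, two of any three corners share their first coordinate and two share
-- their second; such pairs differ by ± f and ± e, hence e, f ∈ ⟨a, b⟩. So a vertex and an incident
-- edge generate the same subgroup, and this propagates along paths of the Köhler graph.
module Submission where

open import Defs
open import Data.Product using (_,_)
open FiniteAbelianGroup using (Carrier)

open import Level using (0ℓ)
open import Algebra.Bundles using (AbelianGroup)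
open import Algebra.Structures using (IsAbelianGroup)
import Algebra.Properties.AbelianGroup as AbelianGroupProperties
import Algebra.Properties.CommutativeSemigroup as CommutativeSemigroupProperties
open import Data.Bool using (Bool; true; false)
open import Data.Empty using (⊥-elim)
open import Data.Integer as ℤ using (-[1+_]; _⊖_)
import Data.Integer.Properties as ℤₚ
open import Data.List using (map)
open import Data.List.Membership.Propositional using (_∈_)
open import Data.List.Relation.Unary.All using ([]; _∷_)
open import Data.List.Relation.Unary.Any using (here; there)
open import Data.Nat as ℕ using (zero; suc)
import Data.Nat.Properties as ℕₚ
open import Data.Product using (∃; ∃₂; _×_; proj₁; proj₂)
open import Data.Sum using (_⊎_; inj₁; inj₂)
open import Function using (_∘_)
open import Function.Bundles using (mk⇔)
open import Relation.Binary.Core using (Rel)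
open import Relation.Binary.Construct.Closure.ReflexiveTransitive using (fold)
open import Relation.Binary.PropositionalEquality

two-of-three-equal : (x y z : Bool) → x ≡ y ⊎ y ≡ z ⊎ x ≡ z
two-of-three-equal false false _     = inj₁ refl
two-of-three-equal true  true  _     = inj₁ refl
two-of-three-equal false true  false = inj₂ (inj₂ refl)
two-of-three-equal false true  true  = inj₂ (inj₁ refl)
two-of-three-equal true  false false = inj₂ (inj₁ refl)
two-of-three-equal true  false true  = inj₂ (inj₂ refl)

agreeing-pair : ∀ {a ℓ} {X : Set a} (π : X → Bool) (R : Rel X ℓ) {x y z : X} →
                R x y → R y z → R x z → ∃₂ λ u v → π u ≡ π v × R u v
agreeing-pair π R {x} {y} {z} rxy ryz rxz with two-of-three-equal (π x) (π y) (π z)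
... | inj₁ eq        = x , y , eq , rxy
... | inj₂ (inj₁ eq) = y , z , eq , ryz
... | inj₂ (inj₂ eq) = x , z , eq , rxz

module _ (G : FiniteAbelianGroup) where
  open FiniteAbelianGroup G renaming (Carrier to A)
  open IsAbelianGroup isAbelianGroup using (_-_; assoc; comm; identityˡ; identityʳ; inverseʳ)
  open Köhler G

  private
    abelianGroup : AbelianGroup 0ℓ 0ℓ
    abelianGroup = record { isAbelianGroup = isAbelianGroup }

  open AbelianGroupProperties abelianGroup
    using (ε⁻¹≈ε; ⁻¹-involutive; ⁻¹-injective; ⁻¹-∙-comm; ⁻¹-anti-homo‿-; xyx⁻¹≈y; ∙-cancelʳ)
  open CommutativeSemigroupProperties (AbelianGroup.commutativeSemigroup abelianGroup)
    using (interchange)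
  open ≡-Reasoning

  x-0≡x : ∀ x → x - 0# ≡ x
  x-0≡x x = trans (cong (x +_) ε⁻¹≈ε) (identityʳ x)

  -‿distrib-+ : ∀ x y → - (x + y) ≡ - x + - y
  -‿distrib-+ x y = sym (⁻¹-∙-comm x y)

  -x--y≡-[x-y] : ∀ x y → - x - - y ≡ - (x - y)
  -x--y≡-[x-y] x y = begin
    - x + - - y ≡⟨ cong (- x +_) (⁻¹-involutive y) ⟩
    - x + y     ≡⟨ comm (- x) y ⟩
    y - x       ≡⟨ ⁻¹-anti-homo‿- x y ⟨
    - (x - y)   ∎

  x+z-[y+z]≡x-y : ∀ x y z → (x + z) - (y + z) ≡ x - y
  x+z-[y+z]≡x-y x y z = begin
    (x + z) - (y + z)     ≡⟨ cong ((x + z) +_) (-‿distrib-+ y z) ⟩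
    (x + z) + (- y + - z) ≡⟨ interchange x z (- y) (- z) ⟩
    (x - y) + (z - z)     ≡⟨ cong ((x - y) +_) (inverseʳ z) ⟩
    (x - y) + 0#          ≡⟨ identityʳ (x - y) ⟩
    x - y                 ∎

  z+x-[z+y]≡x-y : ∀ x y z → (z + x) - (z + y) ≡ x - y
  z+x-[z+y]≡x-y x y z = trans (cong₂ _-_ (comm z x) (comm z y)) (x+z-[y+z]≡x-y x y z)

  ·ℕ-homo-+ : ∀ m n x → (m ℕ.+ n) ·ℕ x ≡ m ·ℕ x + n ·ℕ x
  ·ℕ-homo-+ zero    n x = sym (identityˡ (n ·ℕ x))
  ·ℕ-homo-+ (suc m) n x = trans (cong (x +_) (·ℕ-homo-+ m n x)) (sym (assoc x _ _))

  ⊖-homo : ∀ m n x → (m ⊖ n) · x ≡ m ·ℕ x - n ·ℕ x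
  ⊖-homo m       zero    x = sym (x-0≡x (m ·ℕ x))
  ⊖-homo zero    (suc n) x = sym (identityˡ _)
  ⊖-homo (suc m) (suc n) x = begin
    (suc m ⊖ suc n) · x     ≡⟨ cong (_· x) (ℤₚ.[1+m]⊖[1+n]≡m⊖n m n) ⟩
    (m ⊖ n) · x             ≡⟨ ⊖-homo m n x ⟩
    m ·ℕ x - n ·ℕ x         ≡⟨ z+x-[z+y]≡x-y (m ·ℕ x) (n ·ℕ x) x ⟨
    suc m ·ℕ x - suc n ·ℕ x ∎

  ·-homo-+ : ∀ m n x → (m ℤ.+ n) · x ≡ m · x + n · x
  ·-homo-+ (ℤ.+ m)    (ℤ.+ n)    x = ·ℕ-homo-+ m n x
  ·-homo-+ (ℤ.+ m)    -[1+ n ] x = ⊖-homo m (suc n) x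
  ·-homo-+ -[1+ m ] (ℤ.+ n)    x = trans (⊖-homo n (suc m) x) (comm _ _)
  ·-homo-+ -[1+ m ] -[1+ n ] x = begin
    - (suc (suc (m ℕ.+ n)) ·ℕ x)  ≡⟨ cong (λ k → - (suc k ·ℕ x)) (ℕₚ.+-suc m n) ⟨
    - ((suc m ℕ.+ suc n) ·ℕ x)    ≡⟨ cong -_ (·ℕ-homo-+ (suc m) (suc n) x) ⟩
    - (suc m ·ℕ x + suc n ·ℕ x)   ≡⟨ -‿distrib-+ _ _ ⟩
    -[1+ m ] · x + -[1+ n ] · x   ∎

  ·-homo-neg : ∀ m x → (ℤ.- m) · x ≡ - (m · x)
  ·-homo-neg (ℤ.+ zero)  x = sym ε⁻¹≈ε
  ·-homo-neg (ℤ.+ suc n) x = refl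
  ·-homo-neg -[1+ n ]  x = sym (⁻¹-involutive _)

  InSpan-+ : ∀ {a b x y} → InSpan a b x → InSpan a b y → InSpan a b (x + y)
  InSpan-+ {a} {b} {x} {y} (m , n , refl) (m′ , n′ , refl) = m ℤ.+ m′ , n ℤ.+ n′ , (begin
    (m · a + n · b) + (m′ · a + n′ · b) ≡⟨ interchange _ _ _ _ ⟩
    (m · a + m′ · a) + (n · b + n′ · b) ≡⟨ cong₂ _+_ (·-homo-+ m m′ a) (·-homo-+ n n′ b) ⟨
    (m ℤ.+ m′) · a + (n ℤ.+ n′) · b     ∎)

  InSpan-neg : ∀ {a b x} → InSpan a b x → InSpan a b (- x)
  InSpan-neg {a} {b} (m , n , refl) = ℤ.- m , ℤ.- n , (begin
    - (m · a + n · b)         ≡⟨ -‿distrib-+ _ _ ⟩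
    - (m · a) + - (n · b)     ≡⟨ cong₂ _+_ (·-homo-neg m a) (·-homo-neg n b) ⟨
    (ℤ.- m) · a + (ℤ.- n) · b ∎)

  infix 4 _∈⟨_,_⟩

  data _∈⟨_,_⟩ : A → A → A → Set where
    generatorˡ : ∀ {a b} → a ∈⟨ a , b ⟩
    generatorʳ : ∀ {a b} → b ∈⟨ a , b ⟩
    0-closed   : ∀ {a b} → 0# ∈⟨ a , b ⟩
    +-closed   : ∀ {a b x y} → x ∈⟨ a , b ⟩ → y ∈⟨ a , b ⟩ → x + y ∈⟨ a , b ⟩
    neg-closed : ∀ {a b x} → x ∈⟨ a , b ⟩ → - x ∈⟨ a , b ⟩

  ∈-diff : ∀ {a b x y} → x ∈⟨ a , b ⟩ → y ∈⟨ a , b ⟩ → x - y ∈⟨ a , b ⟩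
  ∈-diff p q = +-closed p (neg-closed q)

  ∈-diff-sym : ∀ {a b x y} → x - y ∈⟨ a , b ⟩ → y - x ∈⟨ a , b ⟩
  ∈-diff-sym {x = x} {y} p = subst (_∈⟨ _ , _ ⟩) (⁻¹-anti-homo‿- x y) (neg-closed p)

  ·ℕ-closed : ∀ {a b x} n → x ∈⟨ a , b ⟩ → n ·ℕ x ∈⟨ a , b ⟩
  ·ℕ-closed zero    p = 0-closed
  ·ℕ-closed (suc n) p = +-closed p (·ℕ-closed n p)

  ·-closed : ∀ {a b x} m → x ∈⟨ a , b ⟩ → m · x ∈⟨ a , b ⟩
  ·-closed (ℤ.+ n)    p = ·ℕ-closed n p
  ·-closed -[1+ n ] p = neg-closed (·ℕ-closed (suc n) p)

  InSpan⇒∈ : ∀ {a b x} → InSpan a b x → x ∈⟨ a , b ⟩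
  InSpan⇒∈ (m , n , refl) = +-closed (·-closed m generatorˡ) (·-closed n generatorʳ)

  ∈⇒InSpan : ∀ {a b x} → x ∈⟨ a , b ⟩ → InSpan a b x
  ∈⇒InSpan {a} {b} generatorˡ = ℤ.+ 1 , ℤ.+ 0 , sym (trans (identityʳ _) (identityʳ a))
  ∈⇒InSpan {a} {b} generatorʳ = ℤ.+ 0 , ℤ.+ 1 , sym (trans (identityˡ _) (identityʳ b))
  ∈⇒InSpan 0-closed           = ℤ.+ 0 , ℤ.+ 0 , sym (identityʳ 0#)
  ∈⇒InSpan (+-closed p q)     = InSpan-+ (∈⇒InSpan p) (∈⇒InSpan q)
  ∈⇒InSpan (neg-closed p)     = InSpan-neg (∈⇒InSpan p)

  infix 4 _⊑_ _≋_

  _⊑_ : A × A → A × A → Set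
  (a , b) ⊑ (c , d) = a ∈⟨ c , d ⟩ × b ∈⟨ c , d ⟩

  ∈-⊑ : ∀ {a b c d x} → (a , b) ⊑ (c , d) → x ∈⟨ a , b ⟩ → x ∈⟨ c , d ⟩
  ∈-⊑ (a∈ , b∈) generatorˡ     = a∈
  ∈-⊑ (a∈ , b∈) generatorʳ     = b∈
  ∈-⊑ _         0-closed       = 0-closed
  ∈-⊑ ab⊑cd     (+-closed p q) = +-closed (∈-⊑ ab⊑cd p) (∈-⊑ ab⊑cd q)
  ∈-⊑ ab⊑cd     (neg-closed p) = neg-closed (∈-⊑ ab⊑cd p)

  ⊑-trans : ∀ {u v w} → u ⊑ v → v ⊑ w → u ⊑ w
  ⊑-trans (a∈ , b∈) v⊑w = ∈-⊑ v⊑w a∈ , ∈-⊑ v⊑w b∈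

  _≋_ : A × A → A × A → Set
  u ≋ v = u ⊑ v × v ⊑ u

  ≋-refl : ∀ {u} → u ≋ u
  ≋-refl = (generatorˡ , generatorʳ) , (generatorˡ , generatorʳ)

  ≋-sym : ∀ {u v} → u ≋ v → v ≋ u
  ≋-sym (u⊑v , v⊑u) = v⊑u , u⊑v

  ≋-trans : ∀ {u v w} → u ≋ v → v ≋ w → u ≋ w
  ≋-trans (u⊑v , v⊑u) (v⊑w , w⊑v) = ⊑-trans u⊑v v⊑w , ⊑-trans w⊑v v⊑u

  ≋⇒SameSpan : ∀ {a b c d} → (a , b) ≋ (c , d) → SameSpan a b c d
  ≋⇒SameSpan (ab⊑cd , cd⊑ab) x =
    mk⇔ (∈⇒InSpan ∘ ∈-⊑ ab⊑cd ∘ InSpan⇒∈) (∈⇒InSpan ∘ ∈-⊑ cd⊑ab ∘ InSpan⇒∈)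

  sgn : Bool → A → A
  sgn true  x = x
  sgn false x = - x

  sgn-closed : ∀ {a b x} s → x ∈⟨ a , b ⟩ → sgn s x ∈⟨ a , b ⟩
  sgn-closed true  p = p
  sgn-closed false p = neg-closed p

  sgn-closed⁻¹ : ∀ {a b x} s → sgn s x ∈⟨ a , b ⟩ → x ∈⟨ a , b ⟩
  sgn-closed⁻¹ true  p = p
  sgn-closed⁻¹ false p = subst (_∈⟨ _ , _ ⟩) (⁻¹-involutive _) (neg-closed p)

  act-diff : ∀ s c x y → act s c x - act s c y ≡ sgn s (x - y)
  act-diff true  c x y = x+z-[y+z]≡x-y x y c
  act-diff false c x y = trans (x+z-[y+z]≡x-y (- x) (- y) c) (-x--y≡-[x-y] x y)

  act-injective : ∀ s c {x y} → act s c x ≡ act s c y → x ≡ y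
  act-injective true  c = ∙-cancelʳ c _ _
  act-injective false c = ⁻¹-injective ∘ ∙-cancelʳ c _ _

  diff-transfer : ∀ s c s′ c′ {x y u v g h} →
                  act s c x ≡ act s′ c′ u → act s c y ≡ act s′ c′ v →
                  u - v ∈⟨ g , h ⟩ → x - y ∈⟨ g , h ⟩
  diff-transfer s c s′ c′ {x} {y} {u} {v} x↦u y↦v p =
    sgn-closed⁻¹ s (subst (_∈⟨ _ , _ ⟩) same-diff (sgn-closed s′ p))
    where
    same-diff : sgn s′ (u - v) ≡ sgn s (x - y)
    same-diff = begin
      sgn s′ (u - v)                  ≡⟨ act-diff s′ c′ u v ⟨
      act s′ c′ u - act s′ c′ v       ≡⟨ cong₂ _-_ x↦u y↦v ⟨
      act s c x - act s c y           ≡⟨ act-diff s c x y ⟩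
      sgn s (x - y)                   ∎

  corner : A → A → Bool × Bool → A
  corner e f (false , false) = 0#
  corner e f (true  , false) = e
  corner e f (false , true)  = f
  corner e f (true  , true)  = e + f

  corner-∈ : ∀ {e f} β → corner e f β ∈⟨ e , f ⟩
  corner-∈ (false , false) = 0-closed
  corner-∈ (true  , false) = generatorˡ
  corner-∈ (false , true)  = generatorʳ
  corner-∈ (true  , true)  = +-closed generatorˡ generatorʳ

  ∈-corners : ∀ s c e f {x} → x ∈ map (act s c) (quadruple e f) →
              ∃ λ β → x ≡ act s c (corner e f β)
  ∈-corners _ _ _ _ (here p)                         = (false , false) , p
  ∈-corners _ _ _ _ (there (here p))                 = (true  , false) , p
  ∈-corners _ _ _ _ (there (there (here p)))         = (false , true)  , p
  ∈-corners _ _ _ _ (there (there (there (here p)))) = (true  , true)  , p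

  corner-diff-fst : ∀ e f t → corner e f (true , t) - corner e f (false , t) ≡ e
  corner-diff-fst e f false = x-0≡x e
  corner-diff-fst e f true  = trans (cong (_- f) (comm e f)) (xyx⁻¹≈y f e)

  corner-diff-snd : ∀ e f t → corner e f (t , true) - corner e f (t , false) ≡ f
  corner-diff-snd e f false = x-0≡x f
  corner-diff-snd e f true  = xyx⁻¹≈y e f

  Linked : A → A → A → A → Rel (Bool × Bool) 0ℓ
  Linked e f g h β γ = β ≢ γ × corner e f β - corner e f γ ∈⟨ g , h ⟩

  e-∈ : ∀ {e f g h} → (∃₂ λ β γ → proj₂ β ≡ proj₂ γ × Linked e f g h β γ) → e ∈⟨ g , h ⟩
  e-∈ {e} {f} ((true  , t) , (false , t) , refl , _ , p) =
    subst (_∈⟨ _ , _ ⟩) (corner-diff-fst e f t) p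
  e-∈ {e} {f} ((false , t) , (true  , t) , refl , _ , p) =
    subst (_∈⟨ _ , _ ⟩) (corner-diff-fst e f t) (∈-diff-sym p)
  e-∈ ((true  , t) , (true  , t) , refl , β≢γ , _) = ⊥-elim (β≢γ refl)
  e-∈ ((false , t) , (false , t) , refl , β≢γ , _) = ⊥-elim (β≢γ refl)

  f-∈ : ∀ {e f g h} → (∃₂ λ β γ → proj₁ β ≡ proj₁ γ × Linked e f g h β γ) → f ∈⟨ g , h ⟩
  f-∈ {e} {f} ((t , true)  , (t , false) , refl , _ , p) =
    subst (_∈⟨ _ , _ ⟩) (corner-diff-snd e f t) p
  f-∈ {e} {f} ((t , false) , (t , true)  , refl , _ , p) =
    subst (_∈⟨ _ , _ ⟩) (corner-diff-snd e f t) (∈-diff-sym p)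
  f-∈ ((t , true)  , (t , true)  , refl , β≢γ , _) = ⊥-elim (β≢γ refl)
  f-∈ ((t , false) , (t , false) , refl , β≢γ , _) = ⊥-elim (β≢γ refl)

  triangle-⊑ : ∀ {e f g h β γ δ} → Linked e f g h β γ → Linked e f g h γ δ →
               Linked e f g h β δ → (e , f) ⊑ (g , h)
  triangle-⊑ {e} {f} {g} {h} βγ γδ βδ =
    e-∈ (agreeing-pair proj₂ (Linked e f g h) βγ γδ βδ) ,
    f-∈ (agreeing-pair proj₁ (Linked e f g h) βγ γδ βδ)

  inscribed-triangle-≋ : ∀ s c s′ c′ {a b e f} β₀ βa βb → 0# ≢ a → a ≢ b → 0# ≢ b →
    act s c 0# ≡ act s′ c′ (corner e f β₀) → act s c a ≡ act s′ c′ (corner e f βa) →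
    act s c b ≡ act s′ c′ (corner e f βb) → (a , b) ≋ (e , f)
  inscribed-triangle-≋ s c s′ c′ {a} {b} {e} {f} β₀ βa βb 0≢a a≢b 0≢b 0↦ a↦ b↦ =
    (from-corners βa a↦ , from-corners βb b↦) ,
    triangle-⊑ (linked β₀ βa 0≢a 0↦ a↦ (∈-diff 0-closed generatorˡ))
               (linked βa βb a≢b a↦ b↦ (∈-diff generatorˡ generatorʳ))
               (linked β₀ βb 0≢b 0↦ b↦ (∈-diff 0-closed generatorʳ))
    where
    from-corners : ∀ {x} β → act s c x ≡ act s′ c′ (corner e f β) → x ∈⟨ e , f ⟩
    from-corners {x} β x↦ = subst (_∈⟨ _ , _ ⟩) (x-0≡x x)
      (diff-transfer s c s′ c′ x↦ 0↦ (∈-diff (corner-∈ β) (corner-∈ β₀)))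

    linked : ∀ {x y} β γ → x ≢ y → act s c x ≡ act s′ c′ (corner e f β) →
             act s c y ≡ act s′ c′ (corner e f γ) → x - y ∈⟨ a , b ⟩ → Linked e f a b β γ
    linked _ _ x≢y x↦ y↦ p =
      (λ { refl → x≢y (act-injective s c (trans x↦ (sym y↦))) }) ,
      diff-transfer s′ c′ s c (sym x↦) (sym y↦) p

  vertex-nonzero : ∀ {a b} → IsVertex a b → 0# ≢ a × 0# ≢ b
  vertex-nonzero (_ , _ , 2a≢0 , _ , _ , 2b≢0 , _) =
    (λ { refl → 2a≢0 (identityʳ 0#) }) , (λ { refl → 2b≢0 (identityʳ 0#) })

  incident⇒≋ : ∀ {a b e f} → IsVertex a b → Incident a b e f → (a , b) ≋ (e , f)
  incident⇒≋ {e = e} {f} v@(a≢b , _) (s , c , s′ , c′ , m₀ ∷ ma ∷ mb ∷ []) =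
    let (0≢a , 0≢b) = vertex-nonzero v
        (β₀ , 0↦) = ∈-corners s′ c′ e f m₀
        (βa , a↦) = ∈-corners s′ c′ e f ma
        (βb , b↦) = ∈-corners s′ c′ e f mb
    in inscribed-triangle-≋ s c s′ c′ β₀ βa βb 0≢a a≢b 0≢b 0↦ a↦ b↦

  adjacent⇒≋ : ∀ {u v} → Adjacent u v → u ≋ v
  adjacent⇒≋ {_ , _} {_ , _} (vᵤ , vᵥ , _ , _ , _ , iᵤ , iᵥ) =
    ≋-trans (incident⇒≋ vᵤ iᵤ) (≋-sym (incident⇒≋ vᵥ iᵥ))

  sameComponent⇒≋ : ∀ {u v} → SameComponent u v → u ≋ v
  sameComponent⇒≋ = fold _≋_ (≋-trans ∘ adjacent⇒≋) ≋-refl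

open Köhler

lemma3p7 : (G : FiniteAbelianGroup) (a b c d : Carrier G) →
    IsVertex G a b → IsVertex G c d →
    SameComponent G (a , b) (c , d) → SameSpan G a b c d
lemma3p7 G a b c d _ _ = ≋⇒SameSpan G ∘ sameComponent⇒≋ G
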